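{- There exist small categories $\mathcal V,\mathcal W$ and a functor $F:\mathcal V\to\mathcal W$ such that $F^*:\widehat{\mathcal W}\to\widehat{\mathcal V}$ has a left adjoint $F_!:\widehat{\mathcal V}\to\widehat{\mathcal W}$ which cannot be extended to a morphism of CwFs (between the presheaf CwFs $\widehat{\mathcal V}$ and $\widehat{\mathcal W}$).
   Context: $F^*$ is precomposition with $F$. The presheaf CwF on $\mathcal C$: contexts are presheaves; a type over $\Gamma$ is a presheaf on the category of elements of $\Gamma$ (sets $T[\gamma]$ with functorial restrictions), substitution of types is reindexing, terms are global sections, context extension is $(\Gamma.T)(W)=\{(\gamma,t):t\in T[\gamma]\}$. A morphism of CwFs consists of a functor on contexts together with actions on types and terms commuting with substitution (i.e. $F(T[\sigma]) = (FT)[F\sigma]$ and similarly for terms), preserving the empty context and context extension with its projection and variable on the nose. -}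

module Defs where

open import Level using (Level)
open import Data.Unit using (⊤; tt)
open import Data.Unit.Properties using () renaming (_≟_ to _≟⊤_)
open import Data.Product using (Σ; _,_; proj₁; proj₂; _×_)
open import Data.Product.Properties using (Σ-≡,≡→≡; Σ-≡,≡←≡)
open import Relation.Binary.PropositionalEquality hiding ([_])
open import Axiom.UniquenessOfIdentityProofs using (UIP; module Decidable⇒UIP)

record Category : Set₁ where
  infixr 9 _∘_
  field
    Obj     : Set
    Hom     : Obj → Obj → Set
    Hom-set : ∀ {A B} → UIP (Hom A B)
    id      : ∀ {A} → Hom A A
    _∘_     : ∀ {A B D} → Hom B D → Hom A B → Hom A D
    idˡ     : ∀ {A B} (f : Hom A B) → id ∘ f ≡ f
    idʳ     : ∀ {A B} (f : Hom A B) → f ∘ id ≡ f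
    assoc   : ∀ {A B D E} (h : Hom D E) (g : Hom B D) (f : Hom A B) →
              (h ∘ g) ∘ f ≡ h ∘ (g ∘ f)

record Functor (C D : Category) : Set where
  private
    module C = Category C
    module D = Category D
  field
    F₀    : C.Obj → D.Obj
    F₁    : ∀ {A B} → C.Hom A B → D.Hom (F₀ A) (F₀ B)
    F-id  : ∀ {A} → F₁ (C.id {A}) ≡ D.id
    F-∘   : ∀ {A B E} (g : C.Hom B E) (f : C.Hom A B) →
            F₁ (g C.∘ f) ≡ F₁ g D.∘ F₁ f

record Presheaf (C : Category) : Set₁ where
  open Category C
  field
    Ob     : Obj → Set
    Ob-set : ∀ {A} → UIP (Ob A)
    act    : ∀ {A B} → Hom A B → Ob B → Ob A
    act-id : ∀ {A} (x : Ob A) → act id x ≡ x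
    act-∘  : ∀ {A B D} (f : Hom B D) (g : Hom A B) (x : Ob D) →
             act (f ∘ g) x ≡ act g (act f x)

open Presheaf public

record _⇒_ {C : Category} (P Q : Presheaf C) : Set where
  open Category C
  field
    η   : ∀ {A} → Ob P A → Ob Q A
    nat : ∀ {A B} (f : Hom A B) (x : Ob P B) → η (act P f x) ≡ act Q f (η x)

open _⇒_ public

module _ {C : Category} where
  open Category C using (Obj)

  _≈_ : {P Q : Presheaf C} → P ⇒ Q → P ⇒ Q → Set
  α ≈ β = ∀ {A : Obj} x → η α {A} x ≡ η β x

  idN : {P : Presheaf C} → P ⇒ P
  idN = record { η = λ x → x ; nat = λ f x → refl }

  infixr 9 _∘N_
  _∘N_ : {P Q R : Presheaf C} → Q ⇒ R → P ⇒ Q → P ⇒ R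
  _∘N_ {P} {Q} {R} β α = record
    { η = λ x → η β (η α x)
    ; nat = λ f x → trans (cong (η β) (nat α f x)) (nat β f (η α x)) }

record PShFunctor (C D : Category) : Set₁ where
  field
    F₀     : Presheaf C → Presheaf D
    F₁     : ∀ {P Q} → P ⇒ Q → F₀ P ⇒ F₀ Q
    F-id   : ∀ {P} → F₁ (idN {P = P}) ≈ idN
    F-∘    : ∀ {P Q R} (β : Q ⇒ R) (α : P ⇒ Q) → F₁ (β ∘N α) ≈ (F₁ β ∘N F₁ α)
    F-resp : ∀ {P Q} {α β : P ⇒ Q} → α ≈ β → F₁ α ≈ F₁ β

open PShFunctor public

_* : ∀ {V W : Category} → Functor V W → PShFunctor W V
_* {V} {W} F = record
  { F₀ = λ Q → record
      { Ob = λ A → Ob Q (F.F₀ A)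
      ; Ob-set = Ob-set Q
      ; act = λ f → act Q (F.F₁ f)
      ; act-id = λ x → trans (cong (λ g → act Q g x) F.F-id) (act-id Q x)
      ; act-∘ = λ f g x → trans (cong (λ h → act Q h x) (F.F-∘ f g)) (act-∘ Q (F.F₁ f) (F.F₁ g) x) }
  ; F₁ = λ α → record { η = η α ; nat = λ f x → nat α (F.F₁ f) x }
  ; F-id = λ x → refl
  ; F-∘ = λ β α x → refl
  ; F-resp = λ e x → e x }
  where module F = Functor F

record _⊣_ {C D : Category} (L : PShFunctor C D) (R : PShFunctor D C) : Set₁ where
  field
    φ      : ∀ {P Q} → F₀ L P ⇒ Q → P ⇒ F₀ R Q
    ψ      : ∀ {P Q} → P ⇒ F₀ R Q → F₀ L P ⇒ Q
    φ-resp : ∀ {P Q} {α β : F₀ L P ⇒ Q} → α ≈ β → φ α ≈ φ β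
    ψ-resp : ∀ {P Q} {α β : P ⇒ F₀ R Q} → α ≈ β → ψ α ≈ ψ β
    φψ     : ∀ {P Q} (β : P ⇒ F₀ R Q) → φ (ψ β) ≈ β
    ψφ     : ∀ {P Q} (α : F₀ L P ⇒ Q) → ψ (φ α) ≈ α
    φ-nat  : ∀ {P′ P Q Q′} (f : P′ ⇒ P) (g : Q ⇒ Q′) (α : F₀ L P ⇒ Q) →
             φ (g ∘N α ∘N F₁ L f) ≈ (F₁ R g ∘N φ α ∘N f)

coe : {A B : Set} → A ≡ B → A → B
coe = subst (λ X → X)

Σ-UIP : {A : Set} {B : A → Set} → UIP A → (∀ {a} → UIP (B a)) → UIP (Σ A B)
Σ-UIP {A} {B} uA uB p q =
  trans (sym (rinv p)) (trans (cong Σ-≡,≡→≡ mid) (rinv q))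
  where
  rinv : ∀ {x y : Σ A B} (r : x ≡ y) → Σ-≡,≡→≡ (Σ-≡,≡←≡ r) ≡ r
  rinv refl = refl
  pair : ∀ {a a′} {b : B a} {b′ : B a′} (e₁ e₂ : a ≡ a′)
         (d₁ : subst B e₁ b ≡ b′) (d₂ : subst B e₂ b ≡ b′) →
         _≡_ {A = Σ (a ≡ a′) (λ e → subst B e b ≡ b′)} (e₁ , d₁) (e₂ , d₂)
  pair e₁ e₂ d₁ d₂ with uA e₁ e₂
  ... | refl = cong (e₁ ,_) (uB d₁ d₂)
  mid = pair (proj₁ (Σ-≡,≡←≡ p)) (proj₁ (Σ-≡,≡←≡ q))
             (proj₂ (Σ-≡,≡←≡ p)) (proj₂ (Σ-≡,≡←≡ q))

module _ {C : Category} where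
  open Category C

  -- A type over Γ: a presheaf (of sets) on the category of elements ∫Γ.
  -- A morphism (A , γ′) → (B , γ) of ∫Γ is an f : Hom A B with act f γ ≡ γ′.
  record Ty (Γ : Presheaf C) : Set₁ where
    field
      T     : ∀ {A} → Ob Γ A → Set
      T-set : ∀ {A} (γ : Ob Γ A) → UIP (T γ)
      tr    : ∀ {A B} (f : Hom A B) {γ : Ob Γ B} {γ′ : Ob Γ A} →
              act Γ f γ ≡ γ′ → T γ → T γ′
      tr-id : ∀ {A} {γ : Ob Γ A} (e : act Γ id γ ≡ γ) (t : T γ) → tr id e t ≡ t
      tr-∘  : ∀ {A B D} (f : Hom B D) (g : Hom A B)
              {γ : Ob Γ D} {γ₁ : Ob Γ B} {γ₂ : Ob Γ A}
              (e₁ : act Γ f γ ≡ γ₁) (e₂ : act Γ g γ₁ ≡ γ₂)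
              (e : act Γ (f ∘ g) γ ≡ γ₂) (t : T γ) →
              tr (f ∘ g) e t ≡ tr g e₂ (tr f e₁ t)

  open Ty public

  -- terms: global sections of the type (presheaf on ∫Γ)
  record Tm (Γ : Presheaf C) (S : Ty Γ) : Set where
    field
      tm     : ∀ {A} (γ : Ob Γ A) → T S γ
      tm-nat : ∀ {A B} (f : Hom A B) {γ : Ob Γ B} {γ′ : Ob Γ A}
               (e : act Γ f γ ≡ γ′) → tm γ′ ≡ tr S f e (tm γ)

  open Tm public

  _[_] : ∀ {Δ Γ : Presheaf C} → Ty Γ → Δ ⇒ Γ → Ty Δ
  _[_] {Δ} {Γ} S σ = record
    { T = λ δ → T S (η σ δ)
    ; T-set = λ δ → T-set S (η σ δ)
    ; tr = λ f {δ} e → tr S f (pth f δ e)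
    ; tr-id = λ e t → tr-id S _ t
    ; tr-∘ = λ f g {δ} e₁ e₂ e t → tr-∘ S f g (pth f δ e₁) _ _ t }
    where
    pth : ∀ {A B} (f : Hom A B) (δ : Ob Δ B) {δ′ : Ob Δ A} →
          act Δ f δ ≡ δ′ → act Γ f (η σ δ) ≡ η σ δ′
    pth f δ e = trans (sym (nat σ f δ)) (cong (η σ) e)

  _[_]t : ∀ {Δ Γ : Presheaf C} {S : Ty Γ} → Tm Γ S → (σ : Δ ⇒ Γ) → Tm Δ (S [ σ ])
  _[_]t {Δ} {Γ} {S} t σ = record
    { tm = λ δ → tm t (η σ δ)
    ; tm-nat = λ f {δ} e → tm-nat t f (trans (sym (nat σ f δ)) (cong (η σ) e)) }

  𝟙 : Presheaf C
  𝟙 = record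
    { Ob = λ _ → ⊤
    ; Ob-set = Decidable⇒UIP.≡-irrelevant _≟⊤_
    ; act = λ _ _ → tt
    ; act-id = λ _ → refl
    ; act-∘ = λ _ _ _ → refl }

  private
    tr-subst : ∀ {Γ : Presheaf C} (S : Ty Γ) {A B} (f : Hom A B) {γ : Ob Γ B}
               {γ′ : Ob Γ A} (e : act Γ f γ ≡ γ′) (t : T S γ) →
               subst (T S) e (tr S f refl t) ≡ tr S f e t
    tr-subst S f refl t = refl

  _▹_ : (Γ : Presheaf C) → Ty Γ → Presheaf C
  Γ ▹ S = record
    { Ob = λ A → Σ (Ob Γ A) (T S)
    ; Ob-set = Σ-UIP (Ob-set Γ) (λ {γ} → T-set S γ)
    ; act = λ f x → act Γ f (proj₁ x) , tr S f refl (proj₂ x)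
    ; act-id = λ x → Σ-≡,≡→≡ (act-id Γ (proj₁ x) ,
                 trans (tr-subst S id _ (proj₂ x)) (tr-id S _ (proj₂ x)))
    ; act-∘ = λ f g x → Σ-≡,≡→≡ (act-∘ Γ f g (proj₁ x) ,
                 trans (tr-subst S (f ∘ g) _ (proj₂ x)) (tr-∘ S f g refl refl _ (proj₂ x))) }

  p : (Γ : Presheaf C) (S : Ty Γ) → (Γ ▹ S) ⇒ Γ
  p Γ S = record { η = proj₁ ; nat = λ f x → refl }

  q : (Γ : Presheaf C) (S : Ty Γ) → Tm (Γ ▹ S) (S [ p Γ S ])
  q Γ S = record { tm = proj₂ ; tm-nat = qnat }
    where
    qnat : ∀ {A B} (f : Hom A B) {x : Σ (Ob Γ B) (T S)} {x′ : Σ (Ob Γ A) (T S)}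
           (e : act (Γ ▹ S) f x ≡ x′) → proj₂ x′ ≡ tr (S [ p Γ S ]) f e (proj₂ x)
    qnat f refl = refl

  -- strict ("on the nose") equality of presheaves, stated extensionally
  record _≐_ (P Q : Presheaf C) : Set₁ where
    field
      ob-eq  : ∀ A → Ob P A ≡ Ob Q A
      act-eq : ∀ {A B} (f : Hom A B) (x : Ob P B) →
               coe (ob-eq A) (act P f x) ≡ act Q f (coe (ob-eq B) x)
  open _≐_ public

  record _≐ₜ_ {Γ : Presheaf C} (S S′ : Ty Γ) : Set₁ where
    field
      ty-eq : ∀ {A} (γ : Ob Γ A) → T S γ ≡ T S′ γ
      tr-eq : ∀ {A B} (f : Hom A B) {γ : Ob Γ B} {γ′ : Ob Γ A}
              (e : act Γ f γ ≡ γ′) (t : T S γ) →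
              coe (ty-eq γ′) (tr S f e t) ≡ tr S′ f e (coe (ty-eq γ) t)
  open _≐ₜ_ public

  TmEq : ∀ {Γ : Presheaf C} {S S′ : Ty Γ} → S ≐ₜ S′ → Tm Γ S → Tm Γ S′ → Set
  TmEq {Γ} E s s′ = ∀ {A} (γ : Ob Γ A) → coe (ty-eq E γ) (tm s γ) ≡ tm s′ γ

record ExtendsToCwFMorphism {V W : Category} (L : PShFunctor V W) : Set₁ where
  field
    FTy    : ∀ {Γ : Presheaf V} → Ty Γ → Ty (F₀ L Γ)
    FTm    : ∀ {Γ : Presheaf V} {S : Ty Γ} → Tm Γ S → Tm (F₀ L Γ) (FTy S)
    ty-sub : ∀ {Δ Γ : Presheaf V} (σ : Δ ⇒ Γ) (S : Ty Γ) →
             FTy (S [ σ ]) ≐ₜ (FTy S [ F₁ L σ ])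
    tm-sub : ∀ {Δ Γ : Presheaf V} (σ : Δ ⇒ Γ) {S : Ty Γ} (t : Tm Γ S) →
             TmEq (ty-sub σ S) (FTm (t [ σ ]t)) (FTm t [ F₁ L σ ]t)
    empty  : F₀ L 𝟙 ≐ 𝟙
    ext    : ∀ (Γ : Presheaf V) (S : Ty Γ) → F₀ L (Γ ▹ S) ≐ (F₀ L Γ ▹ FTy S)
    ext-p  : ∀ (Γ : Presheaf V) (S : Ty Γ) {A} (x : Ob (F₀ L (Γ ▹ S)) A) →
             proj₁ (coe (ob-eq (ext Γ S) A) x) ≡ η (F₁ L (p Γ S)) x
    ext-q  : ∀ (Γ : Presheaf V) (S : Ty Γ) {A} (x : Ob (F₀ L (Γ ▹ S)) A) →
             subst (T (FTy S)) (ext-p Γ S x) (proj₂ (coe (ob-eq (ext Γ S) A) x))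
             ≡ coe (ty-eq (ty-sub (p Γ S) S) x) (tm (FTm (q Γ S)) x)

module Submission where

-- The obstruction is that a CwF morphism preserves the empty context, i.e. the
-- terminal presheaf, on the nose, whereas a left adjoint has no reason to.
-- We take V to be the empty category 𝟘 and W the terminal category 𝟏.
--   * Over 𝟘 every presheaf is "empty", so there is a (vacuous) morphism
--     between any two of them; by the adjunction, any left adjoint L of any
--     R : Ŵ → V̂ therefore admits a map L P ⇒ ∅ into the initial presheaf,
--     so L P has no elements at all (leftAdjoint-out-of-𝟘-empty).
--   * A CwF morphism L has L 𝟙 ≐ 𝟙, so L 𝟙 has an element at every object
--     (cwfMorphism-point).  Hence, as soon as W has an object, no left adjoint
--     out of 𝟘̂ extends to a CwF morphism.
--   * For existence, the constant functor at ∅ is left adjoint to F* for the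
--     unique functor F : 𝟘 → W, for every W.

open import Defs
open import Data.Product using (Σ; _×_; _,_)
open import Data.Empty using (⊥; ⊥-elim)
open import Data.Unit using (⊤; tt)
open import Data.Unit.Properties using (_≟_)
open import Axiom.UniquenessOfIdentityProofs using (module Decidable⇒UIP)
open import Relation.Nullary using (¬_)
open import Relation.Binary.PropositionalEquality using (refl; sym)

𝟘 : Category
𝟘 = record
  { Obj = ⊥ ; Hom = λ _ _ → ⊥ ; Hom-set = λ {A} → ⊥-elim A
  ; id = λ {A} → ⊥-elim A ; _∘_ = λ {A} → ⊥-elim A
  ; idˡ = λ {A} → ⊥-elim A ; idʳ = λ {A} → ⊥-elim A ; assoc = λ {A} → ⊥-elim A }

from𝟘 : (W : Category) → Functor 𝟘 W
from𝟘 W = record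
  { F₀ = ⊥-elim ; F₁ = λ {A} → ⊥-elim A
  ; F-id = λ {A} → ⊥-elim A ; F-∘ = λ {A} → ⊥-elim A }

𝟏 : Category
𝟏 = record
  { Obj = ⊤ ; Hom = λ _ _ → ⊤ ; Hom-set = Decidable⇒UIP.≡-irrelevant _≟_
  ; id = tt ; _∘_ = λ _ _ → tt
  ; idˡ = λ _ → refl ; idʳ = λ _ → refl ; assoc = λ _ _ _ → refl }

over𝟘 : {P Q : Presheaf 𝟘} → P ⇒ Q
over𝟘 = record { η = λ {A} → ⊥-elim A ; nat = λ {A} → ⊥-elim A }

∅ : {C : Category} → Presheaf C
∅ = record
  { Ob = λ _ → ⊥ ; Ob-set = λ {_} {x} → ⊥-elim x ; act = λ _ x → x
  ; act-id = λ _ → refl ; act-∘ = λ _ _ _ → refl }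

¡ : {C : Category} {P : Presheaf C} → ∅ ⇒ P
¡ = record { η = λ () ; nat = λ _ () }

constInitial : (V W : Category) → PShFunctor V W
constInitial V W = record
  { F₀ = λ _ → ∅ ; F₁ = λ _ → idN
  ; F-id = λ _ → refl ; F-∘ = λ _ _ _ → refl ; F-resp = λ _ _ → refl }

-- For F : 𝟘 → W, F* has a left adjoint: the constant initial functor.
-- Both hom-sets of the adjunction are singletons (maps out of ∅, maps over 𝟘).
constInitial⊣from𝟘* : (W : Category) → constInitial 𝟘 W ⊣ (from𝟘 W *)
constInitial⊣from𝟘* W = record
  { φ = λ _ → over𝟘
  ; ψ = λ _ → ¡
  ; φ-resp = λ _ {A} → ⊥-elim A
  ; ψ-resp = λ _ ()
  ; φψ = λ _ {A} → ⊥-elim A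
  ; ψφ = λ _ ()
  ; φ-nat = λ _ _ _ {A} → ⊥-elim A }

-- Conversely, every left adjoint out of 𝟘̂ is pointwise empty: transposing
-- the vacuous map P ⇒ R ∅ gives L P ⇒ ∅.
leftAdjoint-out-of-𝟘-empty :
  {W : Category} {L : PShFunctor 𝟘 W} {R : PShFunctor W 𝟘} → L ⊣ R →
  (P : Presheaf 𝟘) {A : Category.Obj W} → ¬ Ob (F₀ L P) A
leftAdjoint-out-of-𝟘-empty adj P x = η (_⊣_.ψ adj {P} {∅} over𝟘) x

cwfMorphism-point :
  {V W : Category} {L : PShFunctor V W} → ExtendsToCwFMorphism L →
  (A : Category.Obj W) → Ob (F₀ L 𝟙) A
cwfMorphism-point M A = coe (sym (ob-eq (ExtendsToCwFMorphism.empty M) A)) tt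

noCwFLeftAdjoint-out-of-𝟘 :
  {W : Category} → Category.Obj W → {R : PShFunctor W 𝟘}
  (L : PShFunctor 𝟘 W) → L ⊣ R → ¬ ExtendsToCwFMorphism L
noCwFLeftAdjoint-out-of-𝟘 A L adj M =
  leftAdjoint-out-of-𝟘-empty adj 𝟙 (cwfMorphism-point M A)

proposition2p10 : Σ Category λ V → Σ Category λ W → Σ (Functor V W) λ F →
                    Σ (PShFunctor V W) (λ L → L ⊣ (F *))
                    × ((L : PShFunctor V W) → L ⊣ (F *) → ¬ ExtendsToCwFMorphism L)
proposition2p10 =
  𝟘 , 𝟏 , from𝟘 𝟏 ,
  (constInitial 𝟘 𝟏 , constInitial⊣from𝟘* 𝟏) ,
  noCwFLeftAdjoint-out-of-𝟘 tt
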